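{- For all integers $q \geq 2$ and $m \geq 1$, the Hamming graph $H_{q,m}$ satisfies $$\chi_\rho(H_{q,m}) \geq m-1 + q^m - \sum_{k=1}^{m-1} q^{k}.$$
   Context: For integers $q\ge 2$ and $m\ge 1$, the Hamming graph $H_{q,m}$ has vertex set $\{0,\ldots,q-1\}^m$, two vertices being adjacent if and only if they differ in exactly one coordinate (equivalently, $H_{q,m}$ is the Cartesian product of $m$ copies of the complete graph $K_q$). For a graph $G=(V,E)$, a packing $k$-coloring of $G$ is a partition $V_1,\ldots,V_k$ of $V$ such that for every $i\in\{1,\ldots,k\}$, any two distinct vertices $u,v\in V_i$ are at distance at least $i+1$ in $G$. The packing chromatic number $\chi_\rho(G)$ is the smallest $k$ for which a packing $k$-coloring of $G$ exists. -}

module Defs where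

open import Data.Nat using (ℕ; zero; suc; _+_; _∸_; _^_; _≤_)
open import Data.Fin using (Fin; toℕ)
open import Data.Vec using (Vec; _∷_; [])
open import Data.Product using (_×_)
open import Relation.Binary.PropositionalEquality using (_≡_; _≢_)
open import Relation.Nullary using (¬_)

HVertex : ℕ → ℕ → Set
HVertex q m = Vec (Fin q) m

data Adj {q : ℕ} : {m : ℕ} → Vec (Fin q) m → Vec (Fin q) m → Set where
  here  : ∀ {m} {a b : Fin q} {xs : Vec (Fin q) m} → a ≢ b → Adj (a ∷ xs) (b ∷ xs)
  there : ∀ {m} {a : Fin q} {xs ys : Vec (Fin q) m} → Adj xs ys → Adj (a ∷ xs) (a ∷ ys)

data Walk {q m : ℕ} : HVertex q m → HVertex q m → ℕ → Set where
  nil  : ∀ {u} → Walk u u zero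
  cons : ∀ {u v w n} → Adj u v → Walk v w n → Walk u w (suc n)

DistAtLeast : ∀ {q m} → HVertex q m → HVertex q m → ℕ → Set
DistAtLeast u v d = ∀ n → suc n ≤ d → ¬ Walk u v n

-- Packing k-coloring: colour class c⁻¹(j) is V_i with i = toℕ j + 1; distinct
-- vertices of V_i must be at distance at least i + 1.
IsPackingColoring : ∀ {q m} (k : ℕ) → (HVertex q m → Fin k) → Set
IsPackingColoring {q} {m} k c =
  ∀ (u v : HVertex q m) → u ≢ v → c u ≡ c v → DistAtLeast u v (suc (toℕ (c u)) + 1)

sumPow : ℕ → ℕ → ℕ
sumPow q zero = zero
sumPow q (suc n) = sumPow q n + q ^ suc n

-- Write m = n + 1. Two vertices that agree outside their first i coordinates are at distance
-- at most i, so a colour class V_i with i ≤ n has at most q^(m-i) vertices (its vertices are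
-- determined by their last m - i coordinates), while the diameter of H_{q,m} is m, so every
-- class V_i with i > n is a single vertex. Hence q^m ≤ Σ_{i=1}^{n} q^(m-i) + (k - n); as this
-- sum is at most q^m - q, we get k - n ≥ q, so k > n and the bound follows by rearranging.
module Submission where

open import Defs
open import Data.Nat using (ℕ; zero; suc; _+_; _∸_; _*_; _^_; _≤_; _<_; z≤n; s≤s; _<?_)
open import Data.Nat.Properties
open import Data.Fin using (Fin; toℕ; fromℕ<; splitAt; join; combine; finToFun; funToFin)
open import Data.Fin.Properties
  using (toℕ-injective; toℕ<n; fromℕ<-injective; splitAt-join; combine-injective;
         funToFin-finToFin; injective⇒≤)
  renaming (_≟_ to _≟ᶠ_)
open import Data.Vec using ([]; _∷_; tabulate)
open import Data.Vec.Properties using (≡-dec)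
open import Data.Nat.Tactic.RingSolver using (solve-∀)
open import Data.Sum using (_⊎_; inj₁; inj₂)
open import Data.Sum.Properties using (inj₁-injective; inj₂-injective)
open import Data.Product using (∃-syntax; _×_; _,_)
open import Function using (_∘_)
open import Function.Definitions using (Injective)
open import Relation.Binary.PropositionalEquality
open import Relation.Nullary using (yes; no; contradiction)

DistAtMost : ∀ {q m} → HVertex q m → HVertex q m → ℕ → Set
DistAtMost u v d = ∃[ l ] l ≤ d × Walk u v l

lift-walk : ∀ {q m l} {a : Fin q} {xs ys : HVertex q m} → Walk xs ys l → Walk (a ∷ xs) (a ∷ ys) l
lift-walk nil          = nil
lift-walk (cons step w) = cons (there step) (lift-walk w)

distAtMost-refl : ∀ {q m d} {u : HVertex q m} → DistAtMost u u d
distAtMost-refl = 0 , z≤n , nil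

distAtMost-mono : ∀ {q m d e} {u v : HVertex q m} → d ≤ e → DistAtMost u v d → DistAtMost u v e
distAtMost-mono d≤e (l , l≤d , w) = l , ≤-trans l≤d d≤e , w

distAtMost-∷ : ∀ {q m d} (a b : Fin q) {xs ys : HVertex q m} →
               DistAtMost xs ys d → DistAtMost (a ∷ xs) (b ∷ ys) (suc d)
distAtMost-∷ a b (l , l≤d , w) with a ≟ᶠ b
... | yes refl = l , m≤n⇒m≤1+n l≤d , lift-walk w
... | no a≢b   = suc l , s≤s l≤d , cons (here a≢b) (lift-walk w)

distAtMost-diameter : ∀ {q} m (u v : HVertex q m) → DistAtMost u v m
distAtMost-diameter zero    []      []      = distAtMost-refl
distAtMost-diameter (suc m) (a ∷ u) (b ∷ v) = distAtMost-∷ a b (distAtMost-diameter m u v)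

packing-distAtMost⇒≡ : ∀ {q m k} {c : HVertex q m → Fin k} → IsPackingColoring k c →
                       ∀ {u v} → c u ≡ c v → DistAtMost u v (suc (toℕ (c u))) → u ≡ v
packing-distAtMost⇒≡ packing {u} {v} cu≡cv (l , l≤d , w) with ≡-dec _≟ᶠ_ u v
... | yes u≡v = u≡v
... | no  u≢v = contradiction w (packing u v u≢v cu≡cv l (≤-trans (s≤s l≤d) (≤-reflexive (+-comm 1 _))))

vertexCode : ∀ {q m} → HVertex q m → Fin (q ^ m)
vertexCode []      = Fin.zero
vertexCode (a ∷ u) = combine a (vertexCode u)

vertexCode-injective : ∀ {q m} → Injective _≡_ _≡_ (vertexCode {q} {m})
vertexCode-injective {x = []}    {[]}    _  = refl
vertexCode-injective {x = a ∷ u} {b ∷ v} eq with combine-injective a _ b _ eq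
... | refl , codes≡ = cong (a ∷_) (vertexCode-injective codes≡)

vertexCode-tabulate : ∀ {q m} (f : Fin m → Fin q) → vertexCode (tabulate f) ≡ funToFin f
vertexCode-tabulate {m = zero}  f = refl
vertexCode-tabulate {m = suc m} f = cong (combine (f Fin.zero)) (vertexCode-tabulate (λ i → f (Fin.suc i)))

injective⇒^≤ : ∀ {q m N} {f : HVertex q m → Fin N} → Injective _≡_ _≡_ f → q ^ m ≤ N
injective⇒^≤ {q} {m} {f = f} f-injective = injective⇒≤ decode-injective
  where
  decode : Fin (q ^ m) → HVertex q m
  decode i = tabulate (finToFun i)

  vertexCode-decode : ∀ i → vertexCode (decode i) ≡ i
  vertexCode-decode i = trans (vertexCode-tabulate {q} {m} (finToFun i)) (funToFin-finToFin {m} {q} i)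

  decode-injective : Injective _≡_ _≡_ (f ∘ decode)
  decode-injective {i} {j} eq = begin
    i                       ≡⟨ vertexCode-decode i ⟨
    vertexCode (decode i)   ≡⟨ cong vertexCode (f-injective eq) ⟩
    vertexCode (decode j)   ≡⟨ vertexCode-decode j ⟩
    j                       ∎
    where open ≡-Reasoning

join-injective : ∀ m n (x y : Fin m ⊎ Fin n) → join m n x ≡ join m n y → x ≡ y
join-injective m n x y eq = begin
  x                       ≡⟨ splitAt-join m n x ⟨
  splitAt m (join m n x)  ≡⟨ cong (splitAt m) eq ⟩
  splitAt m (join m n y)  ≡⟨ splitAt-join m n y ⟩
  y                       ∎
  where open ≡-Reasoning

-- The code of a vertex u of colour j < n (0-based) records j together with the last n - j
-- coordinates of u; the codes of all j < n together fill sumPow q n = q + ... + q^n.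
lowCode : ∀ {q} n j → j < n → HVertex q (suc n) → Fin (sumPow q n)
lowCode {q} (suc n) zero    _       (_ ∷ u) = join (sumPow q n) (q ^ suc n) (inj₂ (vertexCode u))
lowCode {q} (suc n) (suc j) (s≤s p) (_ ∷ u) = join (sumPow q n) (q ^ suc n) (inj₁ (lowCode n j p u))

lowCode-injective : ∀ {q} n {j j′} (p : j < n) (p′ : j′ < n) {u v : HVertex q (suc n)} →
                    lowCode n j p u ≡ lowCode n j′ p′ v → j ≡ j′ × DistAtMost u v (suc j)
lowCode-injective (suc n) {zero}  {zero}  _ _ {a ∷ u} {b ∷ v} eq
  with refl ← vertexCode-injective {x = u} {v} (inj₂-injective (join-injective _ _ (inj₂ _) (inj₂ _) eq))
  = refl , distAtMost-∷ a b distAtMost-refl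
lowCode-injective (suc n) {suc j} {suc j′} (s≤s p) (s≤s p′) {a ∷ u} {b ∷ v} eq
  with refl , close ← lowCode-injective n p p′ (inj₁-injective (join-injective _ _ (inj₁ _) (inj₁ _) eq))
  = refl , distAtMost-∷ a b close
lowCode-injective (suc n) {zero}  {suc _} _ (s≤s _) {_ ∷ _} {_ ∷ _} eq
  with () ← join-injective _ _ (inj₂ _) (inj₁ _) eq
lowCode-injective (suc n) {suc _} {zero}  (s≤s _) _ {_ ∷ _} {_ ∷ _} eq
  with () ← join-injective _ _ (inj₁ _) (inj₂ _) eq

highCode : ∀ {k n} (i : Fin k) → n ≤ toℕ i → Fin (k ∸ n)
highCode i n≤i = fromℕ< (∸-monoˡ-< (toℕ<n i) n≤i)

highCode-injective : ∀ {k n} {i j : Fin k} (n≤i : n ≤ toℕ i) (n≤j : n ≤ toℕ j) →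
                     highCode i n≤i ≡ highCode j n≤j → i ≡ j
highCode-injective n≤i n≤j eq = toℕ-injective (∸-cancelʳ-≡ n≤i n≤j (fromℕ<-injective _ _ _ _ eq))

module _ {q n k} (c : HVertex q (suc n) → Fin k) where

  colourCode : HVertex q (suc n) → Fin (sumPow q n + (k ∸ n))
  colourCode u with toℕ (c u) <? n
  ... | yes low  = join _ _ (inj₁ (lowCode n (toℕ (c u)) low u))
  ... | no  high = join _ _ (inj₂ (highCode (c u) (≮⇒≥ high)))

  -- A colour i + 1 > n demands distance i + 2 > m, beyond the diameter, so its class is a
  -- single vertex.
  colourCode-injective : IsPackingColoring k c → Injective _≡_ _≡_ colourCode
  colourCode-injective packing {u} {v} eq with toℕ (c u) <? n | toℕ (c v) <? n
  ... | yes low | yes low′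
    with same , close ← lowCode-injective n low low′ (inj₁-injective (join-injective _ _ (inj₁ _) (inj₁ _) eq))
    = packing-distAtMost⇒≡ packing (toℕ-injective same) close
  ... | no high | no high′ = packing-distAtMost⇒≡ packing cu≡cv within-diameter
    where
    cu≡cv : c u ≡ c v
    cu≡cv = highCode-injective (≮⇒≥ high) (≮⇒≥ high′) (inj₂-injective (join-injective _ _ (inj₂ _) (inj₂ _) eq))
    within-diameter : DistAtMost u v (suc (toℕ (c u)))
    within-diameter = distAtMost-mono (s≤s (≮⇒≥ high)) (distAtMost-diameter (suc n) u v)
  ... | yes _ | no _ with () ← join-injective _ _ (inj₁ _) (inj₂ _) eq
  ... | no _ | yes _ with () ← join-injective _ _ (inj₂ _) (inj₁ _) eq

sumPow+q≤^ : ∀ q n → 2 ≤ q → sumPow q n + q ≤ q ^ suc n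
sumPow+q≤^ q zero    _   = ≤-reflexive (sym (*-identityʳ q))
sumPow+q≤^ q (suc n) q≥2 = begin
  sumPow q n + q ^ suc n + q    ≡⟨ swap (sumPow q n) (q ^ suc n) q ⟩
  sumPow q n + q + q ^ suc n    ≤⟨ +-monoˡ-≤ (q ^ suc n) (sumPow+q≤^ q n q≥2) ⟩
  q ^ suc n + q ^ suc n         ≡⟨ cong (q ^ suc n +_) (+-identityʳ (q ^ suc n)) ⟨
  2 * q ^ suc n                 ≤⟨ *-monoˡ-≤ (q ^ suc n) q≥2 ⟩
  q ^ suc (suc n)               ∎
  where
  open ≤-Reasoning
  swap : ∀ a b c → a + b + c ≡ a + c + b
  swap = solve-∀

lemma2 : (q m : ℕ) → 2 ≤ q → 1 ≤ m →
    (k : ℕ) (c : HVertex q m → Fin k) → IsPackingColoring k c →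
    (m ∸ 1) + q ^ m ≤ k + sumPow q (m ∸ 1)
lemma2 q (suc n) q≥2 _ k c packing = begin
  n + q ^ suc n                    ≤⟨ +-monoʳ-≤ n vertices≤codes ⟩
  n + (sumPow q n + (k ∸ n))       ≡⟨ cong (n +_) (+-comm (sumPow q n) (k ∸ n)) ⟩
  n + ((k ∸ n) + sumPow q n)       ≡⟨ +-assoc n (k ∸ n) (sumPow q n) ⟨
  n + (k ∸ n) + sumPow q n         ≡⟨ cong (_+ sumPow q n) (m+[n∸m]≡n n≤k) ⟩
  k + sumPow q n                   ∎
  where
  open ≤-Reasoning
  vertices≤codes : q ^ suc n ≤ sumPow q n + (k ∸ n)
  vertices≤codes = injective⇒^≤ (colourCode-injective c packing)

  q≤k∸n : q ≤ k ∸ n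
  q≤k∸n = +-cancelˡ-≤ (sumPow q n) q (k ∸ n) (≤-trans (sumPow+q≤^ q n q≥2) vertices≤codes)

  n≤k : n ≤ k
  n≤k = <⇒≤ (m∸n≢0⇒n<m (m<n⇒n≢0 (≤-trans q≥2 q≤k∸n)))
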